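{- Let $G$ be a trigraph and let $G'$ be the trigraph obtained from $G$ by adding one new vertex $v$ and joining it by black edges to all vertices of an arbitrary subset $X\subseteq V(G)$ (and to no other vertex). Then $\mathrm{tww}(G')\le 2(\mathrm{tww}(G)+1)$.
   Context: A trigraph is a triple $G=(V,E,R)$ where $E$ and $R$ are disjoint sets of unordered pairs of distinct vertices, the black edges and red edges. For distinct $u,v\in V$, the contraction $G/u,v$ replaces $u,v$ by a new vertex $w$, with $G-\{u,v\}=(G/u,v)-\{w\}$, and for every other vertex $x$: $wx$ is black iff $ux$ and $vx$ are both black; $wx$ is neither black nor red iff neither $ux$ nor $vx$ is black or red; $wx$ is red otherwise. A $d$-trigraph is a trigraph whose red edges form a graph of maximum degree at most $d$. The twin-width $\mathrm{tww}(G)$ of an $n$-vertex trigraph $G$ is the least $d$ such that there is a sequence $G=G_n,G_{n-1},\ldots,G_1$ of $d$-trigraphs with $G_{i-1}$ a contraction of $G_i$ for each $i$ and $G_1$ a single vertex. -}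

module Defs where

open import Data.Nat using (ℕ; zero; suc; _≤_)
open import Data.Bool using (Bool; true; false; if_then_else_)
open import Data.Fin using (Fin; zero; suc; punchIn; punchOut; _≟_)
open import Data.List using (map; allFin)
open import Data.Nat.ListAction using (sum)
open import Relation.Binary.PropositionalEquality using (_≡_; _≢_)
open import Relation.Nullary using (yes; no)

data Col : Set where
  none black red : Col

Trig : ℕ → Set
Trig n = Fin n → Fin n → Col

record IsTrigraph {n : ℕ} (G : Trig n) : Set where
  field
    symm   : ∀ x y → G x y ≡ G y x
    noLoop : ∀ x → G x x ≡ none

-- colour of wx given colours of ux and vx
merge : Col → Col → Col
merge black black = black
merge none  none  = none
merge _     _     = red

-- Contraction G/u,v  (u ≠ v).  Vertex v is deleted (remaining vertices
-- are re-indexed by punchIn v), and u becomes the merged vertex w.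
contract : ∀ {n} → Trig (suc n) → (u v : Fin (suc n)) → v ≢ u → Trig n
contract G u v v≢u x y with x ≟ y | x ≟ w | y ≟ w
  where w = punchOut v≢u
... | yes _ | _     | _     = none
... | no _  | yes _ | _     = merge (G u (punchIn v y)) (G v (punchIn v y))
... | no _  | no _  | yes _ = merge (G u (punchIn v x)) (G v (punchIn v x))
... | no _  | no _  | no _  = G (punchIn v x) (punchIn v y)

isRed : Col → ℕ
isRed red = 1
isRed _   = 0

redDeg : ∀ {n} → Trig n → Fin n → ℕ
redDeg {n} G x = sum (map (λ y → isRed (G x y)) (allFin n))

IsDTrig : ∀ {n} → ℕ → Trig n → Set
IsDTrig d G = ∀ x → redDeg G x ≤ d

data DSeq (d : ℕ) : (n : ℕ) → Trig n → Set where
  done : (G : Trig 1) → IsDTrig d G → DSeq d 1 G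
  step : ∀ {n} (G : Trig (suc (suc n))) → IsDTrig d G →
         (u v : Fin (suc (suc n))) (v≢u : v ≢ u) →
         DSeq d (suc n) (contract G u v v≢u) → DSeq d (suc (suc n)) G

TwwLe : ∀ {n} → Trig n → ℕ → Set
TwwLe {n} G d = DSeq d n G

addVertex : ∀ {n} → Trig n → (Fin n → Bool) → Trig (suc n)
addVertex G X zero    zero    = none
addVertex G X zero    (suc y) = if X y then black else none
addVertex G X (suc x) zero    = if X x then black else none
addVertex G X (suc x) (suc y) = G x y

-- The vertices of G′ are the apex and the vertices of G. Along a d-sequence of G we maintain a
-- contraction H of G′ in which every part y of the current trigraph is represented by at most two
-- vertices, the half of y adjacent to the apex and the half not adjacent to it, while the apex
-- stays alone. Between halves of distinct parts every non-red colour is inherited from the current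
-- trigraph and edges to the apex are never red, so a vertex over p is red only to halves over p or
-- over one of the at most d red neighbours of p. When the sequence contracts u and v into w, the
-- halves of v are merged into the halves of u one at a time; the one extra vertex over w that may
-- exist in between is what the bound 2(d + 1) pays for. Once G is a single vertex, H has at most
-- three vertices.

module Submission where

open import Defs
open import Data.Nat using (ℕ; zero; suc; _+_; _*_; _≤_; z≤n; s≤s; s≤s⁻¹)
open import Data.Nat.Properties
  using (≤-refl; ≤-trans; ≤-reflexive; +-comm; +-identityʳ; +-mono-≤; +-monoˡ-≤; +-monoʳ-≤; +-cancelʳ-≤;
         m≤m+n; m≤n+m; n≤1+n; *-monoʳ-≤; +-commutativeSemigroup; module ≤-Reasoning)
open import Algebra.Properties.CommutativeSemigroup +-commutativeSemigroup using (interchange; x∙yz≈y∙xz)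
open import Data.Bool using (Bool; true; false; not; if_then_else_) renaming (_≟_ to _≟B_)
open import Data.Maybe using (Maybe; just; nothing; maybe)
open import Data.Maybe.Properties using (just-injective)
open import Data.Fin using (Fin; zero; suc; punchIn; punchOut) renaming (_≟_ to _≟F_)
open import Data.Fin.Properties
  using (suc-injective; 0≢1+n; punchIn-punchOut; punchOut-injective; punchIn-injective; punchInᵢ≢i; any?)
open import Data.List using (List; []; _∷_; map; allFin; _++_)
open import Data.List.Properties using (map-tabulate; map-cong; map-++; map-∘)
open import Data.List.Membership.Propositional using (_∈_)
open import Data.List.Membership.Propositional.Properties using (∈-allFin; ∈-map⁺; ∈-++⁺ˡ; ∈-++⁺ʳ)
open import Data.List.Relation.Unary.Any using (here; there; _─_)
open import Data.Nat.ListAction using (sum)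
open import Data.Nat.ListAction.Properties using (sum-++)
open import Data.Product using (∃; _×_; _,_; proj₁; proj₂)
open import Data.Sum using (_⊎_; inj₁; inj₂; [_,_]′)
open import Data.Unit using (⊤; tt)
open import Data.Empty using (⊥-elim)
open import Function using (_∘_; Injective)
open import Relation.Binary.Definitions using (DecidableEquality)
open import Relation.Binary.PropositionalEquality
open import Relation.Nullary using (yes; no; Dec; map′)
open import Relation.Nullary.Decidable using (_×-dec_)

sum-allFin-suc : ∀ {n} (f : Fin (suc n) → ℕ) →
  sum (map f (allFin (suc n))) ≡ f zero + sum (map (f ∘ suc) (allFin n))
sum-allFin-suc {n} f =
  cong (λ xs → f zero + sum xs) (trans (map-tabulate suc f) (sym (map-tabulate (λ i → i) (f ∘ suc))))

sum-map-mono : ∀ {A : Set} {f g : A → ℕ} → (∀ a → f a ≤ g a) → ∀ xs → sum (map f xs) ≤ sum (map g xs)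
sum-map-mono f≤g []       = z≤n
sum-map-mono f≤g (x ∷ xs) = +-mono-≤ (f≤g x) (sum-map-mono f≤g xs)

sum-map-+ : ∀ {A : Set} (f g : A → ℕ) xs → sum (map (λ a → f a + g a) xs) ≡ sum (map f xs) + sum (map g xs)
sum-map-+ f g []       = refl
sum-map-+ f g (x ∷ xs) = trans (cong (f x + g x +_) (sum-map-+ f g xs)) (interchange (f x) (g x) _ _)

sum-map-0 : ∀ {A : Set} {f : A → ℕ} → (∀ a → f a ≡ 0) → ∀ xs → sum (map f xs) ≡ 0
sum-map-0 f≡0 []       = refl
sum-map-0 f≡0 (x ∷ xs) = cong₂ _+_ (f≡0 x) (sum-map-0 f≡0 xs)

sum-allFin-1 : ∀ n → sum (map (λ _ → 1) (allFin n)) ≡ n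
sum-allFin-1 zero    = refl
sum-allFin-1 (suc n) = trans (sum-allFin-suc {n} (λ _ → 1)) (cong suc (sum-allFin-1 n))

δ : ∀ {n} → Fin n → Fin n → ℕ
δ a x with a ≟F x
... | yes _ = 1
... | no  _ = 0

δ-refl : ∀ {n} (x : Fin n) → δ x x ≡ 1
δ-refl x with x ≟F x
... | yes _  = refl
... | no x≢x = ⊥-elim (x≢x refl)

δ-≢ : ∀ {n} {a x : Fin n} → a ≢ x → δ a x ≡ 0
δ-≢ {a = a} {x} a≢x with a ≟F x
... | yes a≡x = ⊥-elim (a≢x a≡x)
... | no  _   = refl

sum-δ : ∀ n (x : Fin n) → sum (map (λ a → δ a x) (allFin n)) ≡ 1
sum-δ (suc n) zero    = trans (sum-allFin-suc {n} (λ a → δ a zero))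
                              (cong suc (sum-map-0 (λ a → δ-≢ {a = suc a} (0≢1+n ∘ sym)) (allFin n)))
sum-δ (suc n) (suc x) = begin
    sum (map (λ a → δ a (suc x)) (allFin (suc n)))
  ≡⟨ sum-allFin-suc {n} (λ a → δ a (suc x)) ⟩
    δ zero (suc x) + sum (map (λ a → δ (suc a) (suc x)) (allFin n))
  ≡⟨ cong sum (map-cong δ-suc (allFin n)) ⟩
    sum (map (λ a → δ a x) (allFin n))
  ≡⟨ sum-δ n x ⟩
    1 ∎
  where
  open ≡-Reasoning
  δ-suc : ∀ a → δ (suc a) (suc x) ≡ δ a x
  δ-suc a with a ≟F x
  ... | yes _ = refl
  ... | no  _ = refl

sum-─ : ∀ {A : Set} (f : A → ℕ) {x xs} (x∈xs : x ∈ xs) → sum (map f xs) ≡ f x + sum (map f (xs ─ x∈xs))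
sum-─ f (here refl)           = refl
sum-─ f {x} {y ∷ xs} (there p) = trans (cong (f y +_) (sum-─ f p)) (x∙yz≈y∙xz (f y) (f x) (sum (map f (xs ─ p))))

∈-─ : ∀ {A : Set} {x y : A} {xs} (x∈xs : x ∈ xs) → y ∈ xs → y ≢ x → y ∈ (xs ─ x∈xs)
∈-─ (here refl) (here refl) y≢x = ⊥-elim (y≢x refl)
∈-─ (here refl) (there q)   _   = q
∈-─ (there p)   (here refl) _   = here refl
∈-─ (there p)   (there q)   y≢x = there (∈-─ p q y≢x)

sum-injective-≤ : ∀ {A : Set} (f : A → ℕ) {K} (g : Fin K → A) → Injective _≡_ _≡_ g →
                  ∀ xs → (∀ a → g a ∈ xs) → sum (map (f ∘ g) (allFin K)) ≤ sum (map f xs)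
sum-injective-≤ _ {zero}  _ _     _  _    = z≤n
sum-injective-≤ f {suc K} g g-inj xs g∈xs = begin
    sum (map (f ∘ g) (allFin (suc K)))
  ≡⟨ sum-allFin-suc (f ∘ g) ⟩
    f (g zero) + sum (map (f ∘ g ∘ suc) (allFin K))
  ≤⟨ +-monoʳ-≤ (f (g zero)) (sum-injective-≤ f (g ∘ suc) (suc-injective ∘ g-inj) (xs ─ g∈xs zero)
                                (λ a → ∈-─ (g∈xs zero) (g∈xs (suc a)) (0≢1+n ∘ sym ∘ g-inj))) ⟩
    f (g zero) + sum (map f (xs ─ g∈xs zero))
  ≡⟨ sym (sum-─ f (g∈xs zero)) ⟩
    sum (map f xs) ∎
  where open ≤-Reasoning

Loopless : ∀ {n} → Trig n → Set
Loopless H = ∀ x → H x x ≡ none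

-- Trigraphs obtained by contraction are not known to be symmetric, so colours are transported
-- in either orientation.
Coloured : ∀ {n} → Trig n → Col → Fin n → Fin n → Set
Coloured G c p q = G p q ≡ c ⊎ G q p ≡ c

isRed≤1 : ∀ c → isRed c ≤ 1
isRed≤1 none  = z≤n
isRed≤1 black = z≤n
isRed≤1 red   = ≤-refl

-- The summand δ a x accounts for x itself, so that the bound can be checked pointwise over all a.
redDeg+1≤ : ∀ {n} (H : Trig n) x (f : Fin n → ℕ) → (∀ a → isRed (H x a) + δ a x ≤ f a) →
            redDeg H x + 1 ≤ sum (map f (allFin n))
redDeg+1≤ {n} H x f bound = begin
    redDeg H x + 1
  ≡⟨ cong (redDeg H x +_) (sym (sum-δ n x)) ⟩
    redDeg H x + sum (map (λ a → δ a x) (allFin n))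
  ≡⟨ sym (sum-map-+ (λ a → isRed (H x a)) (λ a → δ a x) (allFin n)) ⟩
    sum (map (λ a → isRed (H x a) + δ a x) (allFin n))
  ≤⟨ sum-map-mono bound (allFin n) ⟩
    sum (map f (allFin n)) ∎
  where open ≤-Reasoning

loopless⇒IsDTrig : ∀ {K} (H : Trig (suc K)) → Loopless H → IsDTrig K H
loopless⇒IsDTrig {K} H loopless x = +-cancelʳ-≤ 1 _ _ (begin
    redDeg H x + 1                        ≤⟨ redDeg+1≤ H x (λ _ → 1) bound ⟩
    sum (map (λ _ → 1) (allFin (suc K)))  ≡⟨ sum-allFin-1 (suc K) ⟩
    suc K                                 ≡⟨ +-comm 1 K ⟩
    K + 1                                 ∎)
  where
  open ≤-Reasoning
  bound : ∀ a → isRed (H x a) + δ a x ≤ 1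
  bound a with a ≟F x
  ... | yes refl rewrite loopless a = ≤-refl
  ... | no  _    = ≤-trans (≤-reflexive (+-identityʳ _)) (isRed≤1 (H x a))

merge-idem : ∀ {c} → c ≢ red → merge c c ≡ c
merge-idem {none}  _     = refl
merge-idem {black} _     = refl
merge-idem {red}   c≢red = ⊥-elim (c≢red refl)

merge≡-nonred : ∀ {a b c} → c ≢ red → merge a b ≡ c → a ≡ c × b ≡ c
merge≡-nonred {black} {black} _ refl = refl , refl
merge≡-nonred {none}  {none}  _ refl = refl , refl
merge≡-nonred {none}  {black} c≢red e = ⊥-elim (c≢red (sym e))
merge≡-nonred {none}  {red}   c≢red e = ⊥-elim (c≢red (sym e))
merge≡-nonred {black} {none}  c≢red e = ⊥-elim (c≢red (sym e))
merge≡-nonred {black} {red}   c≢red e = ⊥-elim (c≢red (sym e))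
merge≡-nonred {red}           c≢red e = ⊥-elim (c≢red (sym e))

module Contraction {n} (G : Trig (suc n)) (u v : Fin (suc n)) (v≢u : v ≢ u) where

  w : Fin n
  w = punchOut v≢u

  G/uv : Trig n
  G/uv = contract G u v v≢u

  contract-loopless : Loopless G/uv
  contract-loopless x with x ≟F x | x ≟F w | x ≟F w
  ... | yes _ | _ | _ = refl
  ... | no x≢x | _ | _ = ⊥-elim (x≢x refl)

  contract-mergedˡ : ∀ {x y} → x ≢ y → x ≡ w → G/uv x y ≡ merge (G u (punchIn v y)) (G v (punchIn v y))
  contract-mergedˡ {x} {y} x≢y x≡w with x ≟F y | x ≟F w | y ≟F w
  ... | yes x≡y | _       | _ = ⊥-elim (x≢y x≡y)
  ... | no _    | yes _   | _ = refl
  ... | no _    | no x≢w  | _ = ⊥-elim (x≢w x≡w)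

  contract-mergedʳ : ∀ {x y} → x ≢ y → x ≢ w → y ≡ w → G/uv x y ≡ merge (G u (punchIn v x)) (G v (punchIn v x))
  contract-mergedʳ {x} {y} x≢y x≢w y≡w with x ≟F y | x ≟F w | y ≟F w
  ... | yes x≡y | _       | _      = ⊥-elim (x≢y x≡y)
  ... | no _    | yes x≡w | _      = ⊥-elim (x≢w x≡w)
  ... | no _    | no _    | yes _  = refl
  ... | no _    | no _    | no y≢w = ⊥-elim (y≢w y≡w)

  contract-unmerged : ∀ {x y} → x ≢ y → x ≢ w → y ≢ w → G/uv x y ≡ G (punchIn v x) (punchIn v y)
  contract-unmerged {x} {y} x≢y x≢w y≢w with x ≟F y | x ≟F w | y ≟F w
  ... | yes x≡y | _       | _       = ⊥-elim (x≢y x≡y)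
  ... | no _    | yes x≡w | _       = ⊥-elim (x≢w x≡w)
  ... | no _    | no _    | yes y≡w = ⊥-elim (y≢w y≡w)
  ... | no _    | no _    | no _    = refl

  punchIn-w : punchIn v w ≡ u
  punchIn-w = punchIn-punchOut v≢u

  collapse : Fin (suc n) → Fin n
  collapse y with y ≟F v
  ... | yes _   = w
  ... | no  y≢v = punchOut (y≢v ∘ sym)

  collapse-v : collapse v ≡ w
  collapse-v with v ≟F v
  ... | yes _   = refl
  ... | no  v≢v = ⊥-elim (v≢v refl)

  punchIn-collapse : ∀ {y} → y ≢ v → punchIn v (collapse y) ≡ y
  punchIn-collapse {y} y≢v with y ≟F v
  ... | yes y≡v = ⊥-elim (y≢v y≡v)
  ... | no  y≢v = punchIn-punchOut (y≢v ∘ sym)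

  collapse≡w : ∀ {y} → collapse y ≡ w → y ≡ u ⊎ y ≡ v
  collapse≡w {y} e with y ≟F v
  ... | yes y≡v = inj₂ y≡v
  ... | no  y≢v = inj₁ (punchOut-injective (y≢v ∘ sym) v≢u e)

  collapse≢w : ∀ {y} → collapse y ≢ w → y ≢ v
  collapse≢w c≢w refl = c≢w collapse-v

  Above : Fin n → Fin (suc n) → Set
  Above x s = s ≡ punchIn v x ⊎ (x ≡ w × s ≡ v)

  contract-uniform : ∀ {x y c} → x ≢ y → c ≢ red →
                     (∀ {s t} → Above x s → Above y t → G s t ≡ c) →
                     (∀ {s t} → Above y s → Above x t → G s t ≡ c) → G/uv x y ≡ c
  contract-uniform {x} {y} {c} x≢y c≢red xy yx = go (x ≟F w) (y ≟F w)
    where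
    u-above : ∀ {z} → z ≡ w → Above z u
    u-above refl = inj₁ (sym punchIn-w)
    go : Dec (x ≡ w) → Dec (y ≡ w) → G/uv x y ≡ c
    go (yes x≡w) _ = trans (contract-mergedˡ x≢y x≡w)
      (trans (cong₂ merge (xy (u-above x≡w) (inj₁ refl)) (xy (inj₂ (x≡w , refl)) (inj₁ refl))) (merge-idem c≢red))
    go (no x≢w) (yes y≡w) = trans (contract-mergedʳ x≢y x≢w y≡w)
      (trans (cong₂ merge (yx (u-above y≡w) (inj₁ refl)) (yx (inj₂ (y≡w , refl)) (inj₁ refl))) (merge-idem c≢red))
    go (no x≢w) (no y≢w) = trans (contract-unmerged x≢y x≢w y≢w) (xy (inj₁ refl) (inj₁ refl))

  merged-reflect : ∀ {y z c} → y ≡ u ⊎ y ≡ v → c ≢ red → merge (G u z) (G v z) ≡ c → G y z ≡ c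
  merged-reflect (inj₁ refl) c≢red e = proj₁ (merge≡-nonred c≢red e)
  merged-reflect (inj₂ refl) c≢red e = proj₂ (merge≡-nonred c≢red e)

  contract-reflect : ∀ {y y′ c} → collapse y ≢ collapse y′ → c ≢ red →
                     G/uv (collapse y) (collapse y′) ≡ c → Coloured G c y y′
  contract-reflect {y} {y′} {c} distinct c≢red e = go (collapse y ≟F w) (collapse y′ ≟F w)
    where
    go : Dec (collapse y ≡ w) → Dec (collapse y′ ≡ w) → Coloured G c y y′
    go (yes y≡w) (yes y′≡w) = ⊥-elim (distinct (trans y≡w (sym y′≡w)))
    go (yes y≡w) (no  y′≢w) = inj₁ (merged-reflect (collapse≡w y≡w) c≢red
      (subst (λ z → merge (G u z) (G v z) ≡ c) (punchIn-collapse (collapse≢w y′≢w))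
             (trans (sym (contract-mergedˡ distinct y≡w)) e)))
    go (no  y≢w) (yes y′≡w) = inj₂ (merged-reflect (collapse≡w y′≡w) c≢red
      (subst (λ z → merge (G u z) (G v z) ≡ c) (punchIn-collapse (collapse≢w y≢w))
             (trans (sym (contract-mergedʳ distinct y≢w y′≡w)) e)))
    go (no  y≢w) (no  y′≢w) = inj₁
      (subst₂ (λ s t → G s t ≡ c) (punchIn-collapse (collapse≢w y≢w)) (punchIn-collapse (collapse≢w y′≢w))
              (trans (sym (contract-unmerged distinct y≢w y′≢w)) e))

  coloured-reflect : ∀ {y y′ c} → collapse y ≢ collapse y′ → c ≢ red →
                     Coloured G/uv c (collapse y) (collapse y′) → Coloured G c y y′
  coloured-reflect distinct c≢red (inj₁ e) = contract-reflect distinct c≢red e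
  coloured-reflect distinct c≢red (inj₂ e) = [ inj₂ , inj₁ ]′ (contract-reflect (distinct ∘ sym) c≢red e)

loopless⇒DSeq : ∀ {K d} (H : Trig (suc K)) → Loopless H → K ≤ d → DSeq d (suc K) H
loopless⇒DSeq {zero}  H loopless _   = done H (λ x → ≤-trans (loopless⇒IsDTrig H loopless x) z≤n)
loopless⇒DSeq {suc K} H loopless K≤d =
  step H (λ x → ≤-trans (loopless⇒IsDTrig H loopless x) K≤d) zero (suc zero) (λ ())
       (loopless⇒DSeq _ (Contraction.contract-loopless H zero (suc zero) (λ ())) (≤-trans (n≤1+n K) K≤d))

-- A vertex of H is labelled by the apex, by a half of a part y (b records adjacency to the apex),
-- or by a half of the part just merged into w, pending its merge with half w b.
data Label (m : ℕ) : Set where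
  apex    : Label m
  half    : Fin m → Bool → Label m
  pending : Bool → Label m

half-injective : ∀ {m} {y y′ : Fin m} {b b′} → half y b ≡ half y′ b′ → y ≡ y′ × b ≡ b′
half-injective refl = refl , refl

pending-injective : ∀ {m} {b b′} → pending {m} b ≡ pending b′ → b ≡ b′
pending-injective refl = refl

_≟L_ : ∀ {m} → DecidableEquality (Label m)
apex      ≟L apex       = yes refl
apex      ≟L half _ _   = no λ ()
apex      ≟L pending _  = no λ ()
half _ _  ≟L apex       = no λ ()
half y b  ≟L half y′ b′ = map′ (λ (y≡y′ , b≡b′) → cong₂ half y≡y′ b≡b′) half-injective ((y ≟F y′) ×-dec (b ≟B b′))
half _ _  ≟L pending _  = no λ ()
pending _ ≟L apex       = no λ ()
pending _ ≟L half _ _   = no λ ()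
pending b ≟L pending b′ = map′ (cong pending) pending-injective (b ≟B b′)

over : ∀ {m} → Fin m → Label m → Maybe (Fin m)
over w apex        = nothing
over w (half y _)  = just y
over w (pending _) = just w

over≡nothing : ∀ {m} {w : Fin m} ℓ → over w ℓ ≡ nothing → ℓ ≡ apex
over≡nothing apex _ = refl

edge : Bool → Col
edge true  = black
edge false = none

apexColour : ∀ {m} → Label m → Col
apexColour apex        = none
apexColour (half _ b)  = edge b
apexColour (pending b) = edge b

apexColour≢red : ∀ {m} (ℓ : Label m) → apexColour ℓ ≢ red
apexColour≢red apex            ()
apexColour≢red (half _ true)   ()
apexColour≢red (half _ false)  ()
apexColour≢red (pending true)  ()
apexColour≢red (pending false) ()

record Represents {m K} (G : Trig m) (w : Fin m) (H : Trig K) (g : Fin K → Label m) : Set where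
  field
    injective : Injective _≡_ _≡_ g
    loopless  : Loopless H
    lift      : ∀ a b {p q} → over w (g a) ≡ just p → over w (g b) ≡ just q → p ≢ q →
                ∀ {c} → c ≢ red → Coloured G c p q → H a b ≡ c
    apexʳ     : ∀ a b → g b ≡ apex → H a b ≡ apexColour (g a)
    apexˡ     : ∀ a b → g a ≡ apex → H a b ≡ apexColour (g b)

isRed-nonred : ∀ {c} → c ≢ red → isRed c ≡ 0
isRed-nonred {none}  _     = refl
isRed-nonred {black} _     = refl
isRed-nonred {red}   c≢red = ⊥-elim (c≢red refl)

isRed-≤ : ∀ {c c′} → (c ≢ red → c′ ≡ c) → isRed c′ ≤ isRed c
isRed-≤ {none}  {c′} c′≡c rewrite c′≡c (λ ()) = ≤-refl
isRed-≤ {black} {c′} c′≡c rewrite c′≡c (λ ()) = ≤-refl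
isRed-≤ {red}   {c′} _    = isRed≤1 c′

module _ {m} (G : Trig m) where

  redWeight : Fin m → Fin m → ℕ
  redWeight p q with p ≟F q
  ... | yes _ = 1
  ... | no  _ = isRed (G p q)

  redWeight-refl : ∀ p → redWeight p p ≡ 1
  redWeight-refl p with p ≟F p
  ... | yes _   = refl
  ... | no  p≢p = ⊥-elim (p≢p refl)

  redWeight≤1 : ∀ p q → redWeight p q ≤ 1
  redWeight≤1 p q with p ≟F q
  ... | yes _ = ≤-refl
  ... | no  _ = isRed≤1 (G p q)

  redWeight≤ : ∀ p q → redWeight p q ≤ isRed (G p q) + δ q p
  redWeight≤ p q with p ≟F q
  ... | yes refl rewrite δ-refl p = m≤n+m 1 _
  ... | no  _    = m≤m+n _ _

module _ {m} (G : Trig m) (w : Fin m) where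

  labelWeight : Fin m → Label m → ℕ
  labelWeight p ℓ = maybe (redWeight G p) 0 (over w ℓ)

  halves : Bool → List (Label m)
  halves b = map (λ y → half y b) (allFin m)

  labelsWithout : Bool → List (Label m)
  labelsWithout b = pending (not b) ∷ apex ∷ halves true ++ halves false

  ∈-labelsWithout : ∀ b ℓ → ℓ ≢ pending b → ℓ ∈ labelsWithout b
  ∈-labelsWithout _     apex            _  = there (here refl)
  ∈-labelsWithout _     (half y true)   _  = there (there (∈-++⁺ˡ (∈-map⁺ _ (∈-allFin y))))
  ∈-labelsWithout _     (half y false)  _  = there (there (∈-++⁺ʳ (halves true) (∈-map⁺ _ (∈-allFin y))))
  ∈-labelsWithout false (pending true)  _  = here refl
  ∈-labelsWithout true  (pending false) _  = here refl
  ∈-labelsWithout false (pending false) ℓ≢ = ⊥-elim (ℓ≢ refl)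
  ∈-labelsWithout true  (pending true)  ℓ≢ = ⊥-elim (ℓ≢ refl)

  module _ {d} (G-d : IsDTrig d G) where

    sum-halves : ∀ p b → sum (map (labelWeight p) (halves b)) ≤ suc d
    sum-halves p b = begin
        sum (map (labelWeight p) (halves b))
      ≡⟨ cong sum (sym (map-∘ (allFin m))) ⟩
        sum (map (redWeight G p) (allFin m))
      ≤⟨ sum-map-mono (redWeight≤ G p) (allFin m) ⟩
        sum (map (λ q → isRed (G p q) + δ q p) (allFin m))
      ≡⟨ sum-map-+ (λ q → isRed (G p q)) (λ q → δ q p) (allFin m) ⟩
        redDeg G p + sum (map (λ q → δ q p) (allFin m))
      ≡⟨ cong (redDeg G p +_) (sum-δ m p) ⟩
        redDeg G p + 1
      ≤⟨ +-monoˡ-≤ 1 (G-d p) ⟩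
        d + 1
      ≡⟨ +-comm d 1 ⟩
        suc d ∎
      where open ≤-Reasoning

    sum-labelsWithout : ∀ p b → sum (map (labelWeight p) (labelsWithout b)) ≤ 1 + (suc d + suc d)
    sum-labelsWithout p b
      rewrite map-++ (labelWeight p) (halves true) (halves false)
            | sum-++ (map (labelWeight p) (halves true)) (map (labelWeight p) (halves false))
      = +-mono-≤ (redWeight≤1 G p w) (+-mono-≤ (sum-halves p true) (sum-halves p false))

-- labelWeight p ℓ bounds the red edges from a vertex over p to the vertex labelled ℓ, counting the
-- vertex itself when ℓ lies over p; summed over all labels but pending b it is at most 2(d + 1) + 1.
represents⇒IsDTrig : ∀ {d m K} {G : Trig m} {w : Fin m} {H : Trig K} {g : Fin K → Label m} →
                     IsDTrig d G → Represents G w H g → ∀ b → (∀ a → g a ≢ pending b) → IsDTrig (2 * suc d) H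
represents⇒IsDTrig {d} {m} {K} {G} {w} {H} {g} G-d rep b no-pending x with over w (g x) in over-x
... | nothing = ≤-trans (≤-reflexive (sum-map-0 apex-edge (allFin K))) z≤n
  where
  open Represents rep
  apex-edge : ∀ a → isRed (H x a) ≡ 0
  apex-edge a = trans (cong isRed (apexˡ x a (over≡nothing (g x) over-x))) (isRed-nonred (apexColour≢red (g a)))
... | just p = +-cancelʳ-≤ 1 _ _ (begin
    redDeg H x + 1
  ≤⟨ redDeg+1≤ H x (labelWeight G w p ∘ g) weight-bound ⟩
    sum (map (labelWeight G w p ∘ g) (allFin K))
  ≤⟨ sum-injective-≤ (labelWeight G w p) g injective (labelsWithout G w b)
                     (λ a → ∈-labelsWithout G w b (g a) (no-pending a)) ⟩
    sum (map (labelWeight G w p) (labelsWithout G w b))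
  ≤⟨ sum-labelsWithout G w G-d p b ⟩
    1 + (suc d + suc d)
  ≡⟨ +-comm 1 _ ⟩
    suc d + suc d + 1
  ≡⟨ cong (λ k → suc d + k + 1) (sym (+-identityʳ (suc d))) ⟩
    2 * suc d + 1 ∎)
  where
  open ≤-Reasoning
  open Represents rep
  off-diagonal : ∀ a → isRed (H x a) ≤ labelWeight G w p (g a)
  off-diagonal a with over w (g a) in over-a
  ... | nothing = ≤-reflexive (trans (cong isRed (apexʳ x a (over≡nothing (g a) over-a)))
                                     (isRed-nonred (apexColour≢red (g x))))
  ... | just q with p ≟F q
  ...   | yes _   = isRed≤1 (H x a)
  ...   | no  p≢q = isRed-≤ (λ nonred → lift x a over-x over-a p≢q nonred (inj₁ refl))
  weight-bound : ∀ a → isRed (H x a) + δ a x ≤ labelWeight G w p (g a)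
  weight-bound a with a ≟F x
  ... | yes refl rewrite loopless a | over-x | redWeight-refl G p = ≤-refl
  ... | no  _    rewrite +-identityʳ (isRed (H x a)) = off-diagonal a

NoPending : ∀ {m} → Label m → Set
NoPending ℓ = ∀ b → ℓ ≢ pending b

module Relabel {n} (G : Trig (suc n)) (u v : Fin (suc n)) (v≢u : v ≢ u) where
  open Contraction G u v v≢u

  relabel : Label (suc n) → Label n
  relabel apex        = apex
  relabel (half y b) with y ≟F v
  ... | yes _ = pending b
  ... | no  _ = half (collapse y) b
  relabel (pending b) = pending b  -- never used: labels are relabelled only when none is pending

  unlabel : Label n → Label (suc n)
  unlabel apex        = apex
  unlabel (half y b)  = half (punchIn v y) b
  unlabel (pending b) = half v b

  unlabel-relabel : ∀ ℓ → NoPending ℓ → unlabel (relabel ℓ) ≡ ℓ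
  unlabel-relabel apex        _ = refl
  unlabel-relabel (half y b)  _ with y ≟F v
  ... | yes refl = refl
  ... | no  y≢v  = cong (λ z → half z b) (punchIn-collapse y≢v)
  unlabel-relabel (pending b) np = ⊥-elim (np b refl)

  apexColour-relabel : ∀ ℓ → apexColour (relabel ℓ) ≡ apexColour ℓ
  apexColour-relabel apex        = refl
  apexColour-relabel (half y b) with y ≟F v
  ... | yes _ = refl
  ... | no  _ = refl
  apexColour-relabel (pending b) = refl

  over-relabel : ∀ w₀ ℓ {p} → NoPending ℓ → over w (relabel ℓ) ≡ just p →
                 ∃ λ y → over w₀ ℓ ≡ just y × collapse y ≡ p
  over-relabel w₀ (half y b) _ e with y ≟F v
  ... | yes refl = v , refl , trans collapse-v (just-injective e)
  ... | no  _    = y , refl , just-injective e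
  over-relabel w₀ (pending b) np _ = ⊥-elim (np b refl)

  represents-relabel : ∀ {K} {w₀ : Fin (suc n)} {H : Trig K} {g : Fin K → Label (suc n)} →
                       Represents G w₀ H g → (∀ a → NoPending (g a)) → Represents G/uv w H (relabel ∘ g)
  represents-relabel {w₀ = w₀} {H} {g} rep np = record
    { injective = λ {a} {b} e → injective (begin
        g a                     ≡⟨ sym (unlabel-relabel (g a) (np a)) ⟩
        unlabel (relabel (g a)) ≡⟨ cong unlabel e ⟩
        unlabel (relabel (g b)) ≡⟨ unlabel-relabel (g b) (np b) ⟩
        g b                     ∎)
    ; loopless  = loopless
    ; lift      = lift′
    ; apexʳ     = λ a b e → trans (apexʳ a b (is-apex b e)) (sym (apexColour-relabel (g a)))
    ; apexˡ     = λ a b e → trans (apexˡ a b (is-apex a e)) (sym (apexColour-relabel (g b)))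
    }
    where
    open Represents rep
    open ≡-Reasoning
    is-apex : ∀ a → relabel (g a) ≡ apex → g a ≡ apex
    is-apex a e = trans (sym (unlabel-relabel (g a) (np a))) (cong unlabel e)
    lift′ : ∀ a b {p q} → over w (relabel (g a)) ≡ just p → over w (relabel (g b)) ≡ just q → p ≢ q →
            ∀ {c} → c ≢ red → Coloured G/uv c p q → H a b ≡ c
    lift′ a b over-a over-b p≢q c≢red col
      with over-relabel w₀ (g a) (np a) over-a | over-relabel w₀ (g b) (np b) over-b
    ... | y , over-y , refl | y′ , over-y′ , refl =
      lift a b over-y over-y′ (p≢q ∘ cong collapse) c≢red (coloured-reflect p≢q c≢red col)

module MergeTwins {m K} {G : Trig m} {w : Fin m} {H : Trig (suc K)} {g : Fin (suc K) → Label m}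
                  (rep : Represents G w H g) (a₁ a₂ : Fin (suc K)) (a₂≢a₁ : a₂ ≢ a₁)
                  (same-over : over w (g a₁) ≡ over w (g a₂))
                  (same-apexColour : apexColour (g a₁) ≡ apexColour (g a₂)) where
  open Represents rep
  open Contraction H a₁ a₂ a₂≢a₁ renaming (w to merged)

  g′ : Fin K → Label m
  g′ = g ∘ punchIn a₂

  twin-above : ∀ {x s} → Above x s → over w (g s) ≡ over w (g′ x) × apexColour (g s) ≡ apexColour (g′ x)
  twin-above (inj₁ refl)         = refl , refl
  twin-above (inj₂ (refl , refl)) rewrite punchIn-w = sym same-over , sym same-apexColour

  represents-merge : Represents G w G/uv g′
  represents-merge = record
    { injective = punchIn-injective a₂ _ _ ∘ injective
    ; loopless  = contract-loopless
    ; lift      = lift′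
    ; apexʳ     = λ x y e → proj₁ (apex-edges x y e)
    ; apexˡ     = λ x y e → proj₂ (apex-edges y x e)
    }
    where
    lift′ : ∀ x y {p q} → over w (g′ x) ≡ just p → over w (g′ y) ≡ just q → p ≢ q →
            ∀ {c} → c ≢ red → Coloured G c p q → G/uv x y ≡ c
    lift′ x y over-x over-y p≢q c≢red col = contract-uniform x≢y c≢red
      (λ s t → lift _ _ (lies s over-x) (lies t over-y) p≢q c≢red col)
      (λ s t → lift _ _ (lies s over-y) (lies t over-x) (p≢q ∘ sym) c≢red ([ inj₂ , inj₁ ]′ col))
      where
      lies : ∀ {z s r} → Above z s → over w (g′ z) ≡ just r → over w (g s) ≡ just r
      lies above over-z = trans (proj₁ (twin-above above)) over-z
      x≢y : x ≢ y
      x≢y refl = p≢q (just-injective (trans (sym over-x) over-y))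
    apex-edges : ∀ x y → g′ y ≡ apex → G/uv x y ≡ apexColour (g′ x) × G/uv y x ≡ apexColour (g′ x)
    apex-edges x y e = go (x ≟F y)
      where
      c≢red : apexColour (g′ x) ≢ red
      c≢red = apexColour≢red (g′ x)
      apex-above : ∀ {t} → Above y t → g t ≡ apex
      apex-above above = over≡nothing (g _) (trans (proj₁ (twin-above above)) (cong (over w) e))
      to-apex : ∀ {s t} → Above x s → Above y t → H s t ≡ apexColour (g′ x)
      to-apex above-s above-t = trans (apexʳ _ _ (apex-above above-t)) (proj₂ (twin-above above-s))
      from-apex : ∀ {s t} → Above y s → Above x t → H s t ≡ apexColour (g′ x)
      from-apex above-s above-t = trans (apexˡ _ _ (apex-above above-s)) (proj₂ (twin-above above-t))
      go : Dec (x ≡ y) → G/uv x y ≡ apexColour (g′ x) × G/uv y x ≡ apexColour (g′ x)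
      go (yes refl) = loop , loop
        where
        loop : G/uv x x ≡ apexColour (g′ x)
        loop = trans (contract-loopless x) (cong apexColour (sym e))
      go (no x≢y) = contract-uniform x≢y c≢red to-apex from-apex , contract-uniform (x≢y ∘ sym) c≢red from-apex to-apex

module Retarget {m} (w : Fin m) (b : Bool) where

  retarget : Label m → Label m
  retarget ℓ with ℓ ≟L pending b
  ... | yes _ = half w b
  ... | no  _ = ℓ

  over-retarget : ∀ ℓ → over w (retarget ℓ) ≡ over w ℓ
  over-retarget ℓ with ℓ ≟L pending b
  ... | yes refl = refl
  ... | no  _    = refl

  apexColour-retarget : ∀ ℓ → apexColour (retarget ℓ) ≡ apexColour ℓ
  apexColour-retarget ℓ with ℓ ≟L pending b
  ... | yes refl = refl
  ... | no  _    = refl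

  retarget≢pending : ∀ ℓ → retarget ℓ ≢ pending b
  retarget≢pending ℓ with ℓ ≟L pending b
  ... | yes _ = λ ()
  ... | no  ℓ≢ = ℓ≢

  retarget-preserves-≢pending : ∀ {b′} ℓ → ℓ ≢ pending b′ → retarget ℓ ≢ pending b′
  retarget-preserves-≢pending ℓ ℓ≢ with ℓ ≟L pending b
  ... | yes _ = λ ()
  ... | no  _ = ℓ≢

  retarget-injective : ∀ {ℓ ℓ′} → ℓ ≢ half w b → ℓ′ ≢ half w b → retarget ℓ ≡ retarget ℓ′ → ℓ ≡ ℓ′
  retarget-injective {ℓ} {ℓ′} ℓ≢ ℓ′≢ e with ℓ ≟L pending b | ℓ′ ≟L pending b
  ... | yes refl | yes refl = refl
  ... | yes _    | no  _    = ⊥-elim (ℓ′≢ (sym e))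
  ... | no  _    | yes _    = ⊥-elim (ℓ≢ e)
  ... | no  _    | no  _    = e

  represents-retarget : ∀ {K} {G : Trig m} {H : Trig K} {g : Fin K → Label m} →
                        Represents G w H g → (∀ a → g a ≢ half w b) → Represents G w H (retarget ∘ g)
  represents-retarget {g = g} rep no-half = record
    { injective = λ e → injective (retarget-injective (no-half _) (no-half _) e)
    ; loopless  = loopless
    ; lift      = λ a a′ over-a over-a′ → lift a a′ (trans (sym (over-retarget (g a))) over-a)
                                                  (trans (sym (over-retarget (g a′))) over-a′)
    ; apexʳ     = λ a a′ e → trans (apexʳ a a′ (is-apex a′ e)) (sym (apexColour-retarget (g a)))
    ; apexˡ     = λ a a′ e → trans (apexˡ a a′ (is-apex a e)) (sym (apexColour-retarget (g a′)))
    }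
    where
    open Represents rep
    is-apex : ∀ a → retarget (g a) ≡ apex → g a ≡ apex
    is-apex a e = over≡nothing (g a) (trans (sym (over-retarget (g a))) (cong (over w) e))

dseq-IsDTrig : ∀ {d n} {G : Trig n} → DSeq d n G → IsDTrig d G
dseq-IsDTrig (done _ G-d)         = G-d
dseq-IsDTrig (step _ G-d _ _ _ _) = G-d

labels₁ : List (Label 1)
labels₁ = apex ∷ half zero true ∷ half zero false ∷ []

∈-labels₁ : ∀ ℓ → NoPending ℓ → ℓ ∈ labels₁
∈-labels₁ apex              _  = here refl
∈-labels₁ (half zero true)  _  = there (here refl)
∈-labels₁ (half zero false) _  = there (there (here refl))
∈-labels₁ (pending b)       np = ⊥-elim (np b refl)

module Extension (d : ℕ) where

  D : ℕ
  D = 2 * suc d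

  -- The sequence for H is built front to back, so each phase is given the rest of the
  -- construction as a continuation.
  Onward : ∀ {m} → Trig m → Fin m → (Label m → Set) → Bool → Set
  Onward {m} G w Q b = ∀ {K} (H : Trig (suc K)) (g : Fin (suc K) → Label m) → Represents G w H g →
                       (∀ a → g a ≢ pending b) → (∀ a → Q (g a)) → DSeq D (suc K) H

  merge-pending : ∀ {m} {G : Trig m} {w b Q K} (H : Trig (suc K)) (g : Fin (suc K) → Label m) →
                  Represents G w H g → IsDTrig D H → (∀ a → Q (g a)) → ∀ a₁ a₂ →
                  g a₁ ≡ half w b → g a₂ ≡ pending b → Onward G w Q b → DSeq D (suc K) H
  merge-pending {K = zero} _ _ _ _ _ zero zero half-a₁ pending-a₂ _ with trans (sym half-a₁) pending-a₂
  ... | ()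
  merge-pending {w = w} {K = suc K} H g rep H-D Q-g a₁ a₂ half-a₁ pending-a₂ onward =
    step H H-D a₁ a₂ a₂≢a₁ (onward _ g′ represents-merge no-pending (Q-g ∘ punchIn a₂))
    where
    a₂≢a₁ : a₂ ≢ a₁
    a₂≢a₁ refl with trans (sym half-a₁) pending-a₂
    ... | ()
    open MergeTwins rep a₁ a₂ a₂≢a₁ (trans (cong (over w) half-a₁) (sym (cong (over w) pending-a₂)))
                                    (trans (cong apexColour half-a₁) (sym (cong apexColour pending-a₂)))
    no-pending : ∀ a → g′ a ≢ pending _
    no-pending a e = punchInᵢ≢i a₂ a (Represents.injective rep (trans e (sym pending-a₂)))

  resolve : ∀ {m} {G : Trig m} {w : Fin m} (b : Bool) (Q : Label m → Set) →
            (∀ ℓ → Q ℓ → Q (Retarget.retarget w b ℓ)) →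
            ∀ {K} (H : Trig (suc K)) (g : Fin (suc K) → Label m) → Represents G w H g → IsDTrig D H →
            (∀ a → Q (g a)) → Onward G w Q b → DSeq D (suc K) H
  resolve {w = w} b Q Q-retarget H g rep H-D Q-g onward
    with any? (λ a → g a ≟L pending b) | any? (λ a → g a ≟L half w b)
  ... | no no-pending | _ = onward H g rep (λ a e → no-pending (a , e)) Q-g
  ... | yes _ | no no-half =
    onward H (retarget ∘ g) (represents-retarget rep (λ a e → no-half (a , e)))
           (retarget≢pending ∘ g) (λ a → Q-retarget (g a) (Q-g a))
    where open Retarget w b
  ... | yes (a₂ , pending-a₂) | yes (a₁ , half-a₁) =
    merge-pending {Q = Q} H g rep H-D Q-g a₁ a₂ half-a₁ pending-a₂ onward

  extend : ∀ {m} {G : Trig m} → DSeq d m G → (w : Fin m) → ∀ {K} (H : Trig (suc K)) (g : Fin (suc K) → Label m) →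
           Represents G w H g → (∀ a → NoPending (g a)) → DSeq D (suc K) H
  extend (done _ _) _ {K} H g rep np = loopless⇒DSeq H (Represents.loopless rep) (≤-trans K≤2 (*-monoʳ-≤ 2 (s≤s z≤n)))
    where
    K≤2 : K ≤ 2
    K≤2 = s≤s⁻¹ (subst (_≤ 3) (sum-allFin-1 (suc K))
                  (sum-injective-≤ (λ _ → 1) g (Represents.injective rep) labels₁ (λ a → ∈-labels₁ (g a) (np a))))
  extend (step G G-d u v v≢u rest) _ H g rep np =
    resolve true (λ _ → ⊤) (λ _ _ → tt) H (relabel ∘ g) (represents-relabel rep np)
            (represents⇒IsDTrig G-d rep true (λ a → np a true)) (λ _ → tt) onward-true
    where
    open Contraction G u v v≢u using (G/uv; w)
    open Relabel G u v v≢u using (relabel; represents-relabel)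
    onward-false : Onward G/uv w (λ ℓ → ℓ ≢ pending true) false
    onward-false H g rep no-false no-true = extend rest w H g rep λ { a true → no-true a ; a false → no-false a }
    onward-true : Onward G/uv w (λ _ → ⊤) true
    onward-true H g rep no-true _ =
      resolve false (λ ℓ → ℓ ≢ pending true) (Retarget.retarget-preserves-≢pending w false) H g rep
              (represents⇒IsDTrig (dseq-IsDTrig rest) rep true no-true) no-true onward-false

initialLabel : ∀ {n} → (Fin n → Bool) → Fin (suc n) → Label n
initialLabel X zero    = apex
initialLabel X (suc x) = half x (X x)

represents-addVertex : ∀ {n} (G : Trig (suc n)) → IsTrigraph G → (X : Fin (suc n) → Bool) →
                       Represents G zero (addVertex G X) (initialLabel X)
represents-addVertex G G-trig X = record
  { injective = injective
  ; loopless  = λ { zero → refl ; (suc x) → IsTrigraph.noLoop G-trig x }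
  ; lift      = λ { (suc x) (suc y) refl refl _ _ (inj₁ e) → e
                  ; (suc x) (suc y) refl refl _ _ (inj₂ e) → trans (IsTrigraph.symm G-trig x y) e }
  ; apexʳ     = λ { zero zero _ → refl ; (suc x) zero _ → if-edge (X x) }
  ; apexˡ     = λ { zero zero _ → refl ; zero (suc y) _ → if-edge (X y) }
  }
  where
  injective : ∀ {a b} → initialLabel X a ≡ initialLabel X b → a ≡ b
  injective {zero}  {zero}  _    = refl
  injective {suc a} {suc b} refl = refl
  if-edge : ∀ b → (if b then black else none) ≡ edge b
  if-edge true  = refl
  if-edge false = refl

theorem4p1 : ∀ {n} (G : Trig n) → IsTrigraph G → (X : Fin n → Bool) → (d : ℕ) →
    TwwLe G d → TwwLe (addVertex G X) (2 * suc d)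
theorem4p1 {zero}  G _      X d ()
theorem4p1 {suc n} G G-trig X d G-d =
  Extension.extend d G-d zero  -- any target for pending labels would do: there are none yet
    (addVertex G X) (initialLabel X) (represents-addVertex G G-trig X) no-pending
  where
  no-pending : ∀ a → NoPending (initialLabel X a)
  no-pending zero    _ ()
  no-pending (suc _) _ ()
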